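{- Let $N$ be a lattice and let $P$ be a $d$-dimensional lattice polytope in $N$ with Ehrhart $\delta$-polynomial $\delta_P(t)$ of degree $s$ and codegree $l = d+1-s$. Set $\bar{\delta}_P(t) = (1 + t + \cdots + t^{l-1})\delta_P(t)$. Then there is a unique decomposition \[ \bar{\delta}_{P}(t) = a(t) + t^{l}b(t), \] where $a(t)$ and $b(t)$ are polynomials with integer coefficients satisfying $a(t) = t^{d}a(t^{ -1})$ and $b(t) = t^{d - l}b(t^{ -1})$.
   Context: For a lattice polytope $P$ of dimension $d$ in a lattice $N$ (a polytope whose vertices lie in $N$), let $f_P(m)$ be the number of lattice points of $mP$ for positive integers $m$; this is a polynomial in $m$ of degree $d$ (the Ehrhart polynomial), and one writes $\sum_{m\ge 0} f_P(m)t^m = \delta_P(t)/(1-t)^{d+1}$, where $\delta_P(t)$ is a polynomial of degree at most $d$ with non-negative integer coefficients, called the (Ehrhart) $\delta$-polynomial of $P$. Its degree $s$ is the degree of $P$, and $l = d+1-s$ is the codegree of $P$. -}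

module Defs where

open import Data.Nat as ℕ using (ℕ; zero; suc; _≤_; _<_; _∸_)
open import Data.Nat.Combinatorics using (_C_)
open import Data.Integer as ℤ using (ℤ; +_)
open import Data.Rational as ℚ using (ℚ; 0ℚ)
open import Data.Fin using (Fin; zero; suc)
open import Data.Vec using (Vec; lookup)
open import Data.Vec.Membership.Propositional using (_∈_)
open import Data.Product using (Σ; ∃; _×_; _,_)
open import Relation.Binary.PropositionalEquality using (_≡_; _≢_)
open import Function.Bundles using (_⇔_)
open import Relation.Nullary using (¬_)

-- The lattice N is identified with ℤⁿ; a point of N is a vector of integers.
Point : ℕ → Set
Point n = Vec ℤ n

ℤ→ℚ : ℤ → ℚ
ℤ→ℚ z = z ℚ./ 1

ℕ→ℚ : ℕ → ℚ
ℕ→ℚ m = (+ m) ℚ./ 1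

Σℚ : ∀ {k} → (Fin k → ℚ) → ℚ
Σℚ {zero}  f = 0ℚ
Σℚ {suc k} f = f zero ℚ.+ Σℚ (λ i → f (suc i))

Σℤ≤ : ℕ → (ℕ → ℤ) → ℤ
Σℤ≤ zero    f = f 0
Σℤ≤ (suc m) f = Σℤ≤ m f ℤ.+ f (suc m)

Σℤ< : ℕ → (ℕ → ℤ) → ℤ
Σℤ< zero    f = + 0
Σℤ< (suc r) f = Σℤ< r f ℤ.+ f r

-- A lattice polytope P = conv(V) given by finitely many (k ≥ 1) lattice points
-- V : Fin k → N.  x ∈ m·P  iff x is a combination Σ λᵢ vᵢ with λᵢ ≥ 0 rational,
-- Σ λᵢ = m.
InDilate : ∀ {n k} → (Fin k → Point n) → ℕ → Point n → Set
InDilate {n} V m x =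
  Σ (_ → ℚ) λ lam →
    (∀ i → 0ℚ ℚ.≤ lam i) ×
    (Σℚ lam ≡ ℕ→ℚ m) ×
    (∀ (c : Fin n) → Σℚ (λ i → lam i ℚ.* ℤ→ℚ (lookup (V i) c)) ≡ ℤ→ℚ (lookup x c))

LatticePointCount : ∀ {n k} → (Fin k → Point n) → ℕ → ℕ → Set
LatticePointCount {n} V m c =
  Σ (Vec (Point n) c) λ ps →
    (∀ i j → lookup ps i ≡ lookup ps j → i ≡ j) ×
    (∀ (x : Point n) → (InDilate V m x ⇔ (x ∈ ps)))

AffinelyIndependent : ∀ {n r} → (Fin r → Point n) → Set
AffinelyIndependent {n} w =
  ∀ (μ : _ → ℚ) → Σℚ μ ≡ 0ℚ →
    (∀ (c : Fin n) → Σℚ (λ i → μ i ℚ.* ℤ→ℚ (lookup (w i) c)) ≡ 0ℚ) →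
    ∀ i → μ i ≡ 0ℚ

HasDimension : ∀ {n k} → (Fin k → Point n) → ℕ → Set
HasDimension {n} {k} V d =
  (Σ (Fin (suc d) → Fin k) λ g → AffinelyIndependent (λ i → V (g i))) ×
  (∀ (g : Fin (suc (suc d)) → Fin k) → ¬ AffinelyIndependent (λ i → V (g i)))

-- δ : ℕ → ℤ (coefficient sequence) is the Ehrhart δ-polynomial of the
-- d-dimensional polytope conv(V):  deg δ ≤ d and
-- Σ_m f_P(m) tᵐ = δ(t)/(1-t)^{d+1}, i.e. coefficientwise
-- f_P(m) = Σ_{j=0}^{m} δ_j · C(m - j + d, d).
IsDeltaPolynomial : ∀ {n k} → (Fin k → Point n) → ℕ → (ℕ → ℤ) → Set
IsDeltaPolynomial V d δ =
  (∀ j → d < j → δ j ≡ + 0) ×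
  (∀ m c → LatticePointCount V m c →
     + c ≡ Σℤ≤ m (λ j → δ j ℤ.* + ((m ∸ j ℕ.+ d) C d)))

HasDegree : (ℕ → ℤ) → ℕ → Set
HasDegree p s = (p s ≢ + 0) × (∀ j → s < j → p j ≡ + 0)

deltaBar : ℕ → (ℕ → ℤ) → ℕ → ℤ
deltaBar l δ j = Σℤ< l (λ i → shift i j)
  where
  shift : ℕ → ℕ → ℤ
  shift i j with i ℕ.≤? j
  ... | Relation.Nullary.yes _ = δ (j ∸ i)
  ... | Relation.Nullary.no  _ = + 0

shiftBy : ℕ → (ℕ → ℤ) → ℕ → ℤ
shiftBy l b j with l ℕ.≤? j
... | Relation.Nullary.yes _ = b (j ∸ l)
... | Relation.Nullary.no  _ = + 0

-- a(t) ∈ ℤ[t] satisfies a(t) = t^e a(t^{-1})  (for an integer exponent e, here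
-- written e = D - L with D, L natural, allowing e = -1): a is a polynomial of
-- degree ≤ e (a = 0 if e < 0) with a_i = a_{e-i}.
Palindromic : ℕ → ℕ → (ℕ → ℤ) → Set
Palindromic D L a =
  (∀ i → a i ≢ + 0 → i ℕ.+ L ≤ D) ×
  (∀ i j → i ℕ.+ j ℕ.+ L ≡ D → a i ≡ a j)

IsDecomposition : ℕ → ℕ → (ℕ → ℤ) → (ℕ → ℤ) → (ℕ → ℤ) → Set
IsDecomposition d l h a b =
  Palindromic d 0 a × Palindromic d l b × (∀ j → h j ≡ a j ℤ.+ shiftBy l b j)

module Submission where

-- Only two facts about δ are used: it vanishes above its degree s, and s ≤ d
-- (the δ-polynomial has degree at most d), so that l = d + 1 - s ≥ 1.
--
-- Write S i = δ₀ + … + δᵢ for the partial sums; S i = S s for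
-- i ≥ s.  Multiplying by 1 + t + … + t^{l-1} telescopes:  δ̄ᵢ = S i - S (i-l).
-- Take the "mirrored partial sums"
--     aᵢ = S i + S (d-i) - S s            (0 ≤ i ≤ d),
--     bᵢ = S s - S i - S (d-l-i)          (0 ≤ i ≤ d-l),
-- both palindromic because their kernels are symmetric in the two indices
-- (lemma reflect-palindromic); the identity δ̄ = a + tˡ b is checked in the
-- three ranges i < l, l ≤ i ≤ d, d < i.
--
-- For any decomposition of any h with l ≥ 1, a is forced by
-- strong induction: aᵢ = hᵢ for i < l, aᵢ = 0 for i > d, and for l ≤ i ≤ d the
-- two symmetries give aᵢ = hᵢ - (h_{d-i+l} - a_{i-l}); then bⱼ = h_{j+l} - a_{j+l}.

open import Defs
open import Data.Nat using (ℕ; suc; _∸_; _+_)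
open import Data.Integer using (ℤ)
open import Data.Fin using (Fin)
open import Data.Product using (Σ; _×_)
open import Relation.Binary.PropositionalEquality using (_≡_)

open import Data.Nat as ℕ using (zero; _≤_; _<_; z≤n; s≤s)
import Data.Nat.Properties as ℕP
open import Data.Nat.Induction using (<-rec)
open import Data.Nat.Tactic.RingSolver using () renaming (solve-∀ to ℕ-solve-∀)
open import Data.Integer as ℤ using (+_; _-_)
import Data.Integer.Properties as ℤP
open import Data.Integer.Tactic.RingSolver using (solve-∀)
open import Data.Product using (_,_; proj₁; proj₂)
open import Data.Empty using (⊥-elim)
open import Relation.Nullary using (yes; no; ¬_)
open import Relation.Binary.PropositionalEquality
  using (_≢_; refl; sym; trans; cong; cong₂; module ≡-Reasoning)

open ≡-Reasoning

subtract-left : ∀ {x y z : ℤ} → x ≡ y ℤ.+ z → z ≡ x - y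
subtract-left {x} {y} {z} x≡y+z = trans (solve z y) (cong (_- y) (sym x≡y+z))
  where
  solve : ∀ z y → z ≡ (y ℤ.+ z) - y
  solve = solve-∀

subtract-right : ∀ {x y z : ℤ} → x ≡ y ℤ.+ z → y ≡ x - z
subtract-right {x} {y} {z} x≡y+z = trans (solve y z) (cong (_- z) (sym x≡y+z))
  where
  solve : ∀ y z → y ≡ (y ℤ.+ z) - z
  solve = solve-∀

shiftBy-≤ : ∀ {l j} (f : ℕ → ℤ) → l ≤ j → shiftBy l f j ≡ f (j ∸ l)
shiftBy-≤ {l} {j} f l≤j with l ℕ.≤? j
... | yes _   = refl
... | no l≰j  = ⊥-elim (l≰j l≤j)

shiftBy-< : ∀ {l j} (f : ℕ → ℤ) → j < l → shiftBy l f j ≡ + 0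
shiftBy-< {l} {j} f j<l with l ℕ.≤? j
... | yes l≤j = ⊥-elim (ℕP.<⇒≱ j<l l≤j)
... | no _    = refl

shiftBy-+ : ∀ l j (f : ℕ → ℤ) → shiftBy l f (j + l) ≡ f j
shiftBy-+ l j f = trans (shiftBy-≤ f (ℕP.m≤n+m l j)) (cong f (ℕP.m+n∸n≡m j l))

palindromic-vanishes : ∀ {D L a} → Palindromic D L a → ∀ i → ¬ (i + L ≤ D) → a i ≡ + 0
palindromic-vanishes {a = a} (support , _) i out with a i ℤ.≟ + 0
... | yes aᵢ≡0 = aᵢ≡0
... | no aᵢ≢0  = ⊥-elim (out (support i aᵢ≢0))

reflect : ℕ → ℕ → (ℕ → ℕ → ℤ) → ℕ → ℤ
reflect D L g i with i + L ℕ.≤? D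
... | yes _ = g i (D ∸ (i + L))
... | no _  = + 0

reflect-in : ∀ {D L i} (g : ℕ → ℕ → ℤ) → i + L ≤ D → reflect D L g i ≡ g i (D ∸ (i + L))
reflect-in {D} {L} {i} g inside with i + L ℕ.≤? D
... | yes _  = refl
... | no out = ⊥-elim (out inside)

reflect-out : ∀ {D L i} (g : ℕ → ℕ → ℤ) → ¬ (i + L ≤ D) → reflect D L g i ≡ + 0
reflect-out {D} {L} {i} g out with i + L ℕ.≤? D
... | yes inside = ⊥-elim (out inside)
... | no _       = refl

reflect-palindromic : ∀ D L (g : ℕ → ℕ → ℤ) → (∀ i j → g i j ≡ g j i) →
                      Palindromic D L (reflect D L g)
reflect-palindromic D L g g-sym = support , symmetric
  where
  support : ∀ i → reflect D L g i ≢ + 0 → i + L ≤ D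
  support i nonzero with i + L ℕ.≤? D
  ... | yes inside = inside
  ... | no _       = ⊥-elim (nonzero refl)

  reorder : ∀ i j L → i + j + L ≡ (i + L) + j
  reorder = ℕ-solve-∀

  within : ∀ i j → i + j + L ≡ D → i + L ≤ D
  within i j eq = ℕP.≤-trans (ℕP.m≤m+n (i + L) j) (ℕP.≤-reflexive (trans (sym (reorder i j L)) eq))

  complement : ∀ i j → i + j + L ≡ D → D ∸ (i + L) ≡ j
  complement i j eq = begin
    D ∸ (i + L)           ≡⟨ cong (_∸ (i + L)) (trans (sym eq) (reorder i j L)) ⟩
    (i + L) + j ∸ (i + L) ≡⟨ ℕP.m+n∸m≡n (i + L) j ⟩
    j                     ∎

  symmetric : ∀ i j → i + j + L ≡ D → reflect D L g i ≡ reflect D L g j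
  symmetric i j eq = begin
    reflect D L g i   ≡⟨ reflect-in g (within i j eq) ⟩
    g i (D ∸ (i + L)) ≡⟨ cong (g i) (complement i j eq) ⟩
    g i j             ≡⟨ g-sym i j ⟩
    g j i             ≡⟨ cong (g j) (sym (complement j i eq′)) ⟩
    g j (D ∸ (j + L)) ≡⟨ sym (reflect-in g (within j i eq′)) ⟩
    reflect D L g j   ∎
    where
    eq′ : j + i + L ≡ D
    eq′ = trans (cong (_+ L) (ℕP.+-comm j i)) eq

shiftBy-suc : ∀ L i (f : ℕ → ℤ) → shiftBy (suc L) f (suc i) ≡ shiftBy L f i
shiftBy-suc L i f with L ℕ.≤? i
... | yes L≤i = shiftBy-≤ f (s≤s L≤i)
... | no L≰i  = shiftBy-< f (s≤s (ℕP.≰⇒> L≰i))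

shiftBy-below-1 : ∀ L (f : ℕ → ℤ) → shiftBy (suc L) f 0 ≡ + 0
shiftBy-below-1 L f = shiftBy-< {suc L} {0} f (s≤s z≤n)

deltaBar-suc : ∀ L (δ : ℕ → ℤ) i → deltaBar (suc L) δ i ≡ deltaBar L δ i ℤ.+ shiftBy L δ i
deltaBar-suc L δ i with L ℕ.≤? i
... | yes _ = refl
... | no _  = refl

-- Partial sums S i = δ₀ + … + δᵢ, the coefficients of δ(t)/(1 - t).
partialSum : (ℕ → ℤ) → ℕ → ℤ
partialSum δ i = Σℤ≤ i δ

shiftBy-partialSum : ∀ (δ : ℕ → ℤ) L i →
  shiftBy L (partialSum δ) i ≡ shiftBy (suc L) (partialSum δ) i ℤ.+ shiftBy L δ i
shiftBy-partialSum δ zero zero =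
  sym (trans (cong (ℤ._+ δ 0) (shiftBy-below-1 zero (partialSum δ))) (ℤP.+-identityˡ (δ 0)))
shiftBy-partialSum δ zero (suc i) =
  cong (ℤ._+ δ (suc i)) (sym (shiftBy-suc zero i (partialSum δ)))
shiftBy-partialSum δ (suc L) zero = begin
  shiftBy (suc L) (partialSum δ) 0                           ≡⟨ shiftBy-below-1 L (partialSum δ) ⟩
  + 0                                                        ≡⟨ sym (cong₂ ℤ._+_ (shiftBy-below-1 (suc L) (partialSum δ)) (shiftBy-below-1 L δ)) ⟩
  shiftBy (suc (suc L)) (partialSum δ) 0 ℤ.+ shiftBy (suc L) δ 0 ∎
shiftBy-partialSum δ (suc L) (suc i) = begin
  shiftBy (suc L) (partialSum δ) (suc i)                       ≡⟨ shiftBy-suc L i (partialSum δ) ⟩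
  shiftBy L (partialSum δ) i                                   ≡⟨ shiftBy-partialSum δ L i ⟩
  shiftBy (suc L) (partialSum δ) i ℤ.+ shiftBy L δ i           ≡⟨ sym (cong₂ ℤ._+_ (shiftBy-suc (suc L) i (partialSum δ)) (shiftBy-suc L i δ)) ⟩
  shiftBy (suc (suc L)) (partialSum δ) (suc i) ℤ.+ shiftBy (suc L) δ (suc i) ∎

-- Telescoping: (1 + t + … + t^{L-1}) δ(t) = (1 - tᴸ) · δ(t)/(1 - t).
deltaBar-partialSums : ∀ L (δ : ℕ → ℤ) i →
  deltaBar L δ i ≡ partialSum δ i - shiftBy L (partialSum δ) i
deltaBar-partialSums zero δ i = sym (ℤP.+-inverseʳ (partialSum δ i))
deltaBar-partialSums (suc L) δ i = begin
  deltaBar (suc L) δ i                ≡⟨ deltaBar-suc L δ i ⟩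
  deltaBar L δ i ℤ.+ shiftBy L δ i    ≡⟨ cong (ℤ._+ shiftBy L δ i) (deltaBar-partialSums L δ i) ⟩
  S i - shiftBy L S i ℤ.+ shiftBy L δ i ≡⟨ cong (λ x → S i - x ℤ.+ shiftBy L δ i) (shiftBy-partialSum δ L i) ⟩
  S i - (shiftBy (suc L) S i ℤ.+ shiftBy L δ i) ℤ.+ shiftBy L δ i ≡⟨ cancel (S i) (shiftBy (suc L) S i) (shiftBy L δ i) ⟩
  S i - shiftBy (suc L) S i           ∎
  where
  S = partialSum δ
  cancel : ∀ x y z → x - (y ℤ.+ z) ℤ.+ z ≡ x - y
  cancel = solve-∀

partialSum-stable : ∀ (δ : ℕ → ℤ) s → (∀ j → s < j → δ j ≡ + 0) →
                    ∀ {m} → s ≤ m → partialSum δ m ≡ partialSum δ s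
partialSum-stable δ s vanish s≤m = go (ℕP.≤⇒≤′ s≤m)
  where
  go : ∀ {m} → s ℕ.≤′ m → partialSum δ m ≡ partialSum δ s
  go ℕ.≤′-refl = refl
  go (ℕ.≤′-step {m} s≤′m) = begin
    partialSum δ m ℤ.+ δ (suc m) ≡⟨ cong (λ x → partialSum δ m ℤ.+ x) (vanish (suc m) (s≤s (ℕP.≤′⇒≤ s≤′m))) ⟩
    partialSum δ m ℤ.+ + 0       ≡⟨ ℤP.+-identityʳ (partialSum δ m) ⟩
    partialSum δ m               ≡⟨ go s≤′m ⟩
    partialSum δ s               ∎

module Existence (δ : ℕ → ℤ) (s : ℕ) (vanish : ∀ j → s < j → δ j ≡ + 0)
                 (l d : ℕ) (s+l≡1+d : s + l ≡ suc d) where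

  S : ℕ → ℤ
  S = partialSum δ

  S-stable : ∀ {m} → s ≤ m → S m ≡ S s
  S-stable = partialSum-stable δ s vanish

  -- aᵢ = S i + S (d-i) - S s  and  bᵢ = S s - S i - S (d-l-i).
  a : ℕ → ℤ
  a = reflect d 0 (λ i j → S i ℤ.+ S j - S s)

  b : ℕ → ℤ
  b = reflect d l (λ i j → S s - S i - S j)

  a-palindromic : Palindromic d 0 a
  a-palindromic = reflect-palindromic d 0 _ (λ i j → swap (S i) (S j) (S s))
    where
    swap : ∀ x y z → x ℤ.+ y - z ≡ y ℤ.+ x - z
    swap = solve-∀

  b-palindromic : Palindromic d l b
  b-palindromic = reflect-palindromic d l _ (λ i j → swap (S s) (S i) (S j))
    where
    swap : ∀ z x y → z - x - y ≡ z - y - x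
    swap = solve-∀

  a-in : ∀ {i} → i ≤ d → a i ≡ S i ℤ.+ S (d ∸ i) - S s
  a-in {i} i≤d = trans (reflect-in {d} {0} {i} _ (ℕP.≤-trans (ℕP.≤-reflexive (ℕP.+-identityʳ i)) i≤d))
                       (cong (λ k → S i ℤ.+ S (d ∸ k) - S s) (ℕP.+-identityʳ i))

  a-out : ∀ {i} → d < i → a i ≡ + 0
  a-out {i} d<i = reflect-out {d} {0} {i} _ (λ i+0≤d → ℕP.<⇒≱ d<i (ℕP.m+n≤o⇒m≤o i i+0≤d))

  l≤1+d : l ≤ suc d
  l≤1+d = ℕP.m+n≤o⇒n≤o s (ℕP.≤-reflexive s+l≡1+d)

  -- Below l: δ̄ⱼ = S j, and S (d-j) = S s because d - j ≥ s.
  identity-low : ∀ {j} → j < l → deltaBar l δ j ≡ a j ℤ.+ shiftBy l b j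
  identity-low {j} j<l = begin
    deltaBar l δ j                ≡⟨ deltaBar-partialSums l δ j ⟩
    S j - shiftBy l S j           ≡⟨ cong (S j -_) (shiftBy-< S j<l) ⟩
    S j - + 0                     ≡⟨ rearrange (S j) (S s) ⟩
    S j ℤ.+ S s - S s ℤ.+ + 0     ≡⟨ sym (cong₂ ℤ._+_ a-low (shiftBy-< b j<l)) ⟩
    a j ℤ.+ shiftBy l b j         ∎
    where
    s+j≤d : s + j ≤ d
    -- s + (j + 1) ≤ s + l = d + 1
    s+j≤d = ℕP.≤-pred (ℕP.≤-trans (ℕP.≤-reflexive (sym (ℕP.+-suc s j)))
                       (ℕP.≤-trans (ℕP.+-monoʳ-≤ s j<l) (ℕP.≤-reflexive s+l≡1+d)))
    a-low : a j ≡ S j ℤ.+ S s - S s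
    a-low = trans (a-in (ℕP.m+n≤o⇒n≤o s s+j≤d))
                  (cong (λ x → S j ℤ.+ x - S s) (S-stable (ℕP.m+n≤o⇒m≤o∸n s s+j≤d)))
    rearrange : ∀ x y → x - + 0 ≡ x ℤ.+ y - y ℤ.+ + 0
    rearrange = solve-∀

  -- For l ≤ j ≤ d, with m = j - l:  δ̄ⱼ = S j - S m,  aⱼ = S j + S (d-j) - S s,
  -- b_m = S s - S m - S (d-j); the S s and S (d-j) terms cancel.
  identity-middle : ∀ {j} → l ≤ j → j ≤ d → deltaBar l δ j ≡ a j ℤ.+ shiftBy l b j
  identity-middle {j} l≤j j≤d = begin
    deltaBar l δ j                                     ≡⟨ deltaBar-partialSums l δ j ⟩
    S j - shiftBy l S j                                ≡⟨ cong (S j -_) (shiftBy-≤ S l≤j) ⟩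
    S j - S m                                          ≡⟨ cancel (S j) (S m) (S (d ∸ j)) (S s) ⟩
    (S j ℤ.+ S (d ∸ j) - S s) ℤ.+ (S s - S m - S (d ∸ j)) ≡⟨ sym (cong₂ ℤ._+_ (a-in j≤d) b-middle) ⟩
    a j ℤ.+ shiftBy l b j                              ∎
    where
    m : ℕ
    m = j ∸ l
    m+l≡j : m + l ≡ j
    m+l≡j = ℕP.m∸n+n≡m l≤j
    b-middle : shiftBy l b j ≡ S s - S m - S (d ∸ j)
    b-middle = begin
      shiftBy l b j                  ≡⟨ shiftBy-≤ b l≤j ⟩
      b m                            ≡⟨ reflect-in {d} {l} {m} _ (ℕP.≤-trans (ℕP.≤-reflexive m+l≡j) j≤d) ⟩
      S s - S m - S (d ∸ (m + l))    ≡⟨ cong (λ k → S s - S m - S (d ∸ k)) m+l≡j ⟩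
      S s - S m - S (d ∸ j)          ∎
    cancel : ∀ x y e z → x - y ≡ (x ℤ.+ e - z) ℤ.+ (z - y - e)
    cancel = solve-∀

  -- Above d both sides vanish: δ̄ⱼ = S j - S (j-l) = S s - S s since j - l ≥ s.
  identity-high : ∀ {j} → d < j → deltaBar l δ j ≡ a j ℤ.+ shiftBy l b j
  identity-high {j} d<j = begin
    deltaBar l δ j          ≡⟨ deltaBar-partialSums l δ j ⟩
    S j - shiftBy l S j     ≡⟨ cong₂ _-_ (S-stable s≤j) (trans (shiftBy-≤ S l≤j) (S-stable s≤m)) ⟩
    S s - S s               ≡⟨ ℤP.+-inverseʳ (S s) ⟩
    + 0 ℤ.+ + 0             ≡⟨ sym (cong₂ ℤ._+_ (a-out d<j) b-high) ⟩
    a j ℤ.+ shiftBy l b j   ∎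
    where
    l≤j : l ≤ j
    l≤j = ℕP.≤-trans l≤1+d d<j
    m : ℕ
    m = j ∸ l
    m+l≡j : m + l ≡ j
    m+l≡j = ℕP.m∸n+n≡m l≤j
    -- s + l = d + 1 ≤ j = m + l
    s≤m : s ≤ m
    s≤m = ℕP.+-cancelʳ-≤ l s m (ℕP.≤-trans (ℕP.≤-reflexive s+l≡1+d)
                                 (ℕP.≤-trans d<j (ℕP.≤-reflexive (sym m+l≡j))))
    s≤j : s ≤ j
    s≤j = ℕP.≤-trans s≤m (ℕP.m∸n≤m j l)
    b-high : shiftBy l b j ≡ + 0
    b-high = trans (shiftBy-≤ b l≤j)
                   (reflect-out {d} {l} {m} _ (λ m+l≤d → ℕP.<⇒≱ d<j (ℕP.≤-trans (ℕP.≤-reflexive (sym m+l≡j)) m+l≤d)))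

  decomposition : IsDecomposition d l (deltaBar l δ) a b
  decomposition = a-palindromic , b-palindromic , identity
    where
    identity : ∀ j → deltaBar l δ j ≡ a j ℤ.+ shiftBy l b j
    identity j with j ℕ.<? l | j ℕ.≤? d
    ... | yes j<l | _       = identity-low j<l
    ... | no j≮l  | yes j≤d = identity-middle (ℕP.≮⇒≥ j≮l) j≤d
    ... | no _    | no j≰d  = identity-high (ℕP.≰⇒> j≰d)

-- Uniqueness, for any h and any l ≥ 1: the coefficients of a decomposition
-- are forced, those of a by a recursion running downwards by steps of l.
module Forced {d l : ℕ} {h a b : ℕ → ℤ} (D : IsDecomposition d l h a b) where

  private
    a-palindromic : Palindromic d 0 a
    a-palindromic = proj₁ D
    b-palindromic : Palindromic d l b
    b-palindromic = proj₁ (proj₂ D)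
    h≡a+tˡb : ∀ j → h j ≡ a j ℤ.+ shiftBy l b j
    h≡a+tˡb = proj₂ (proj₂ D)

  a-low : ∀ {i} → i < l → a i ≡ h i
  a-low {i} i<l = sym (begin
    h i                   ≡⟨ h≡a+tˡb i ⟩
    a i ℤ.+ shiftBy l b i ≡⟨ cong (λ x → a i ℤ.+ x) (shiftBy-< b i<l) ⟩
    a i ℤ.+ + 0           ≡⟨ ℤP.+-identityʳ (a i) ⟩
    a i                   ∎)

  a-high : ∀ {i} → d < i → a i ≡ + 0
  a-high {i} d<i = palindromic-vanishes a-palindromic i
                     (λ i+0≤d → ℕP.<⇒≱ d<i (ℕP.m+n≤o⇒m≤o i i+0≤d))

  b-forced : ∀ j → b j ≡ h (j + l) - a (j + l)
  b-forced j = subtract-left (trans (h≡a+tˡb (j + l)) (cong (λ x → a (j + l) ℤ.+ x) (shiftBy-+ l j b)))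

  -- For l ≤ i ≤ d, with m = i - l and e = d - i (so m + e + l = d):
  -- aᵢ = hᵢ - b_m = hᵢ - b_e = hᵢ - (h_{e+l} - a_{e+l}) = hᵢ - (h_{e+l} - a_m).
  a-middle : ∀ {i} → l ≤ i → i ≤ d → a i ≡ h i - (h (d ∸ i + l) - a (i ∸ l))
  a-middle {i} l≤i i≤d = begin
    a i                         ≡⟨ subtract-right (h≡a+tˡb i) ⟩
    h i - shiftBy l b i         ≡⟨ cong (h i -_) (shiftBy-≤ b l≤i) ⟩
    h i - b m                   ≡⟨ cong (h i -_) (proj₂ b-palindromic m e m+e+l≡d) ⟩
    h i - b e                   ≡⟨ cong (h i -_) (b-forced e) ⟩
    h i - (h (e + l) - a (e + l)) ≡⟨ cong (λ x → h i - (h (e + l) - x)) (proj₂ a-palindromic (e + l) m e+l+m+0≡d) ⟩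
    h i - (h (e + l) - a m)     ∎
    where
    m e : ℕ
    m = i ∸ l
    e = d ∸ i
    -- both index sums equal (m + l) + e = i + e = d
    i+e≡d : (m + l) + e ≡ d
    i+e≡d = trans (cong (_+ e) (ℕP.m∸n+n≡m l≤i)) (ℕP.m+[n∸m]≡n i≤d)
    reorder₁ : ∀ m e l → m + e + l ≡ (m + l) + e
    reorder₁ = ℕ-solve-∀
    reorder₂ : ∀ m e l → e + l + m + 0 ≡ (m + l) + e
    reorder₂ = ℕ-solve-∀
    m+e+l≡d : m + e + l ≡ d
    m+e+l≡d = trans (reorder₁ m e l) i+e≡d
    e+l+m+0≡d : e + l + m + 0 ≡ d
    e+l+m+0≡d = trans (reorder₂ m e l) i+e≡d

decomposition-unique : ∀ {d l h a b a′ b′} → 0 < l →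
  IsDecomposition d l h a b → IsDecomposition d l h a′ b′ →
  (∀ i → a′ i ≡ a i) × (∀ j → b′ j ≡ b j)
decomposition-unique {d} {l} {h} {a} {b} {a′} {b′} 0<l D D′ = a-agree , b-agree
  where
  module F = Forced D
  module F′ = Forced D′

  a-agree : ∀ i → a′ i ≡ a i
  a-agree = <-rec (λ i → a′ i ≡ a i) step
    where
    step : ∀ i → (∀ {k} → k < i → a′ k ≡ a k) → a′ i ≡ a i
    step i earlier with i ℕ.<? l | i ℕ.≤? d
    ... | yes i<l | _       = trans (F′.a-low i<l) (sym (F.a-low i<l))
    ... | no i≮l  | yes i≤d = begin
      a′ i                                  ≡⟨ F′.a-middle l≤i i≤d ⟩
      h i - (h (d ∸ i + l) - a′ (i ∸ l))    ≡⟨ cong (λ x → h i - (h (d ∸ i + l) - x)) (earlier (ℕP.∸-monoʳ-< 0<l l≤i)) ⟩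
      h i - (h (d ∸ i + l) - a (i ∸ l))     ≡⟨ sym (F.a-middle l≤i i≤d) ⟩
      a i                                   ∎
      where
      l≤i : l ≤ i
      l≤i = ℕP.≮⇒≥ i≮l
    ... | no _    | no i≰d  = trans (F′.a-high (ℕP.≰⇒> i≰d)) (sym (F.a-high (ℕP.≰⇒> i≰d)))

  b-agree : ∀ j → b′ j ≡ b j
  b-agree j = begin
    b′ j                        ≡⟨ F′.b-forced j ⟩
    h (j + l) - a′ (j + l)      ≡⟨ cong (h (j + l) -_) (a-agree (j + l)) ⟩
    h (j + l) - a (j + l)       ≡⟨ sym (F.b-forced j) ⟩
    b j                         ∎

-- The δ-polynomial has degree s ≤ d, so l = d + 1 - s ≥ 1 and s + l = d + 1;
-- existence and uniqueness then apply.
lemma2p3 : ∀ (n k : ℕ) (V : Fin (suc k) → Point n) (d : ℕ) (δ : ℕ → ℤ) (s : ℕ)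
    → HasDimension V d → IsDeltaPolynomial V d δ → HasDegree δ s
    → let l = suc d ∸ s in
      Σ (ℕ → ℤ) (λ a → Σ (ℕ → ℤ) (λ b →
        IsDecomposition d l (deltaBar l δ) a b
        × (∀ a′ b′ → IsDecomposition d l (deltaBar l δ) a′ b′
             → (∀ i → a′ i ≡ a i) × (∀ i → b′ i ≡ b i))))
lemma2p3 n k V d δ s _ (δ-vanishes-above-d , _) (δₛ≢0 , δ-vanishes-above-s) =
  a , b , decomposition , λ _ _ D′ → decomposition-unique 0<l decomposition D′
  where
  -- δ s ≠ 0, while δ vanishes above d
  s≤d : s ≤ d
  s≤d with s ℕ.≤? d
  ... | yes s≤d = s≤d
  ... | no s≰d  = ⊥-elim (δₛ≢0 (δ-vanishes-above-d s (ℕP.≰⇒> s≰d)))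

  0<l : 0 < suc d ∸ s
  0<l = ℕP.m<n⇒0<n∸m (s≤s s≤d)

  open Existence δ s δ-vanishes-above-s (suc d ∸ s) d (ℕP.m+[n∸m]≡n (ℕP.m≤n⇒m≤1+n s≤d))
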